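{- Let $X$ be a set and let $f$ be a complementary choice function on $X$. Let $St(f)=\{A\subseteq X : f(A)=A\}$. Then $$f=\bigcup_{K\in St(f)} f_K,$$ that is, $f(A)=\bigcup_{K\in St(f)} f_K(A)$ for every $A\subseteq X$.
   Context: A choice function (CF) on a set $X$ is a map $f:2^X\to 2^X$ with $f(A)\subseteq A$ for all $A\subseteq X$. A CF $f$ is consistent if $f(A)\subseteq B\subseteq A$ implies $f(B)=f(A)$; it is monotonic if $A\subseteq B$ implies $f(A)\subseteq f(B)$; it is complementary if it is both consistent and monotonic. For $K\subseteq X$, the packaged CF $f_K$ is defined by $f_K(A)=K$ if $K\subseteq A$ and $f_K(A)=\emptyset$ otherwise. -}

module Defs where

open import Level using (0ℓ) renaming (suc to lsuc)
open import Data.Product using (Σ; _×_)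
open import Relation.Unary using (Pred; _⊆_; _≐_; _∈_)

Subset : Set → Set₁
Subset X = Pred X 0ℓ

-- Since subsets are represented by predicates, we also require that f
-- respects (extensional) equality of subsets, as any function on
-- genuine subsets does.
record IsChoiceFunction {X : Set} (f : Subset X → Subset X) : Set₁ where
  field
    sub     : ∀ A → f A ⊆ A
    respect : ∀ {A B} → A ≐ B → f A ≐ f B

Consistent : {X : Set} → (Subset X → Subset X) → Set₁
Consistent f = ∀ A B → f A ⊆ B → B ⊆ A → f B ≐ f A

Monotonic : {X : Set} → (Subset X → Subset X) → Set₁
Monotonic f = ∀ A B → A ⊆ B → f A ⊆ f B

record IsComplementary {X : Set} (f : Subset X → Subset X) : Set₁ where
  field
    isChoice   : IsChoiceFunction f
    consistent : Consistent f
    monotonic  : Monotonic f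

-- packaged CF: f_K(A) = K if K ⊆ A, ∅ otherwise
-- (x ∈ f_K(A) iff K ⊆ A and x ∈ K)
packaged : {X : Set} → Subset X → Subset X → Subset X
packaged K A x = K ⊆ A × x ∈ K

St : {X : Set} → (Subset X → Subset X) → Subset X → Set
St f A = f A ≐ A

unionPackaged : {X : Set} → (Subset X → Subset X) → Subset X → Pred X (lsuc 0ℓ)
unionPackaged f A x = Σ (Subset _) λ K → St f K × x ∈ packaged K A

module Submission where

open import Defs
open import Relation.Unary using (_≐_; _⊆_)
open import Data.Product using (_,_)

-- Every value f A is itself stable and packages to f A on A; conversely a
-- stable K ⊆ A lies in f K = K, hence by monotonicity in f A.

image-stable : {X : Set} (f : Subset X → Subset X) →
               (∀ A → f A ⊆ A) → Consistent f → ∀ A → St f (f A)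
image-stable f sub consistent A = consistent A (f A) (λ x∈fA → x∈fA) (sub A)

stable-packaged-⊆ : {X : Set} (f : Subset X → Subset X) → Monotonic f →
                    ∀ {K} A → St f K → packaged K A ⊆ f A
stable-packaged-⊆ f monotonic A (_ , K⊆fK) (K⊆A , x∈K) =
  monotonic _ A K⊆A (K⊆fK x∈K)

theorem1 : {X : Set} (f : Subset X → Subset X) → IsComplementary f →
    ∀ A → f A ≐ unionPackaged f A
theorem1 f complementary A =
    (λ x∈fA → f A , image-stable f sub consistent A , sub A , x∈fA)
  , (λ { (K , K-stable , x∈fKA) → stable-packaged-⊆ f monotonic A K-stable x∈fKA })
  where
    open IsComplementary complementary
    open IsChoiceFunction isChoice
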